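{- Let $(P,\le)$ be a poset and $\Theta$ a congruence on $(P,\le)$. Assume that the intervals $[a,b]=\{x\in P\mid a\le x\le b\}$ and $[c,d]=\{x\in P\mid c\le x\le d\}$ (with $a\le b$, $c\le d$) are classes of $\Theta$. Then $a\le c$ if and only if $b\le d$.
   Context: For a poset $(P,\le)$ and $x,y\in P$ let $L(x,y)=\{z\in P\mid z\le x,\ z\le y\}$ and $U(x,y)=\{z\in P\mid x\le z,\ y\le z\}$; for $A\subseteq P$, $\operatorname{Max}A$ and $\operatorname{Min}A$ denote the sets of maximal and minimal elements of $A$. A binary relation $R$ on $P$ is compatible with a map $Q\colon P^2\to 2^P$ if whenever $(a_1,b_1),(a_2,b_2)\in R$ there exist $a\in Q(a_1,a_2)$ and $b\in Q(b_1,b_2)$ with $(a,b)\in R$. A congruence on $(P,\le)$ is an equivalence relation on $P$ compatible with both $(x,y)\mapsto\operatorname{Max}L(x,y)$ and $(x,y)\mapsto\operatorname{Min}U(x,y)$. -}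

module Defs where

open import Level using (Level; _⊔_; suc)
open import Data.Product using (_×_; Σ-syntax; ∃-syntax)
open import Relation.Binary.Core using (Rel)
open import Relation.Binary.Structures using (IsPartialOrder; IsEquivalence)
open import Relation.Binary.PropositionalEquality using (_≡_)
open import Function.Bundles using (_⇔_)

record Poset (c ℓ : Level) : Set (Level.suc (c ⊔ ℓ)) where
  field
    Carrier        : Set c
    _≤_            : Rel Carrier ℓ
    isPartialOrder : IsPartialOrder _≡_ _≤_

module _ {c ℓ : Level} (P : Poset c ℓ) where
  open Poset P

  Subset : (r : Level) → Set (c ⊔ Level.suc r)
  Subset r = Carrier → Set r

  L : Carrier → Carrier → Subset ℓ
  L x y z = (z ≤ x) × (z ≤ y)

  U : Carrier → Carrier → Subset ℓ
  U x y z = (x ≤ z) × (y ≤ z)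

  Max : ∀ {r} → Subset r → Subset (c ⊔ ℓ ⊔ r)
  Max A z = A z × (∀ w → A w → z ≤ w → w ≡ z)

  Min : ∀ {r} → Subset r → Subset (c ⊔ ℓ ⊔ r)
  Min A z = A z × (∀ w → A w → w ≤ z → w ≡ z)

  MaxL : Carrier → Carrier → Subset (c ⊔ ℓ)
  MaxL x y = Max (L x y)

  MinU : Carrier → Carrier → Subset (c ⊔ ℓ)
  MinU x y = Min (U x y)

  Compatible : ∀ {r q} → Rel Carrier r → (Carrier → Carrier → Subset q) → Set (c ⊔ r ⊔ q)
  Compatible R Q = ∀ {a₁ b₁ a₂ b₂} → R a₁ b₁ → R a₂ b₂ →
    ∃[ a ] ∃[ b ] (Q a₁ a₂ a × Q b₁ b₂ b × R a b)

  record IsCongruence {r} (Θ : Rel Carrier r) : Set (c ⊔ ℓ ⊔ r) where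
    field
      isEquivalence : IsEquivalence Θ
      compatMax     : Compatible Θ MaxL
      compatMin     : Compatible Θ MinU

  Interval : Carrier → Carrier → Subset ℓ
  Interval a b x = (a ≤ x) × (x ≤ b)

  IsClass : ∀ {r s} → Rel Carrier r → Subset s → Set (c ⊔ r ⊔ s)
  IsClass Θ A = ∃[ z ] (∀ x → A x ⇔ Θ z x)

{-# OPTIONS --safe #-}
-- Both endpoint pairs are related (a Θ b, c Θ d), so compatibility with
-- Min U applied to these pairs yields x ∈ Min U(a,c) and y ∈ Min U(b,d) with
-- x Θ y. When a ≤ c the set Min U(a,c) is {c}, hence y lies in the class of c,
-- which is [c,d]; thus b ≤ y ≤ d. The converse is the same argument in the
-- dual poset, where Max L and Min U exchange roles.
module Submission where

open import Defs
open import Level using (Level)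
open import Relation.Binary.Core using (Rel)
open import Relation.Binary.Structures using (IsPartialOrder; IsEquivalence)
open import Relation.Binary.PropositionalEquality using (_≡_; sym; subst)
import Relation.Binary.Construct.Flip.EqAndOrd as Flip
open import Function.Base using (flip; _∘′_)
open import Function.Bundles using (_⇔_; mk⇔; Equivalence)
open import Data.Product using (_,_; _×_; ∃-syntax; proj₂; swap)

dual : ∀ {c ℓ} → Poset c ℓ → Poset c ℓ
dual P = record
  { Carrier        = Carrier
  ; _≤_            = flip _≤_
  ; isPartialOrder = Flip.isPartialOrder isPartialOrder
  }
  where open Poset P

module _ {c ℓ : Level} (P : Poset c ℓ) where
  open Poset P
  open IsPartialOrder isPartialOrder using () renaming (refl to ≤-refl; trans to ≤-trans)

  MinU-of-≤ : ∀ {x y z} → x ≤ y → MinU P x y z → z ≡ y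
  MinU-of-≤ x≤y ((_ , y≤z) , minimal) = sym (minimal _ (x≤y , ≤-refl) y≤z)

  module _ {r} {Θ : Rel Carrier r} (Θ-equiv : IsEquivalence Θ) where
    open IsEquivalence Θ-equiv renaming (sym to Θ-sym; trans to Θ-trans)

    IsClass⇒related : ∀ {s} {A : Subset P s} → IsClass P Θ A →
                      ∀ {x y} → A x → A y → Θ x y
    IsClass⇒related (_ , A⇔Θz) {x} {y} x∈A y∈A =
      Θ-trans (Θ-sym (Equivalence.to (A⇔Θz x) x∈A)) (Equivalence.to (A⇔Θz y) y∈A)

    IsClass-closed : ∀ {s} {A : Subset P s} → IsClass P Θ A →
                     ∀ {x y} → A x → Θ x y → A y
    IsClass-closed (_ , A⇔Θz) {x} {y} x∈A xΘy =
      Equivalence.from (A⇔Θz y) (Θ-trans (Equivalence.to (A⇔Θz x) x∈A) xΘy)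

    Interval-class⇒endpoints-related : ∀ {a b} → a ≤ b →
                                       IsClass P Θ (Interval P a b) → Θ a b
    Interval-class⇒endpoints-related a≤b [a,b] =
      IsClass⇒related [a,b] (≤-refl , a≤b) (a≤b , ≤-refl)

  IsCongruence-dual : ∀ {r} {Θ : Rel Carrier r} →
                      IsCongruence P Θ → IsCongruence (dual P) Θ
  IsCongruence-dual cong = record
    { isEquivalence = isEquivalence
    ; compatMax     = compatMin
    ; compatMin     = compatMax
    }
    where open IsCongruence cong

  IsClass-Interval-dual : ∀ {r} {Θ : Rel Carrier r} {a b} →
                          IsClass P Θ (Interval P a b) →
                          IsClass (dual P) Θ (Interval (dual P) b a)
  IsClass-Interval-dual (z , I⇔Θz) = z , λ x →
    mk⇔ (Equivalence.to (I⇔Θz x) ∘′ swap) (swap ∘′ Equivalence.from (I⇔Θz x))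

  ≤-lower⇒≤-upper : ∀ {r} {Θ : Rel Carrier r} → IsCongruence P Θ →
                    ∀ {a b c′ d} → a ≤ b → c′ ≤ d →
                    IsClass P Θ (Interval P a b) → IsClass P Θ (Interval P c′ d) →
                    a ≤ c′ → b ≤ d
  ≤-lower⇒≤-upper {Θ = Θ} cong {a} {b} {c′} {d} a≤b c′≤d [a,b] [c′,d] a≤c′ =
    upper (compatMin (Interval-class⇒endpoints-related isEquivalence a≤b [a,b])
                     (Interval-class⇒endpoints-related isEquivalence c′≤d [c′,d]))
    where
    open IsCongruence cong
    upper : ∃[ x ] ∃[ y ] (MinU P a c′ x × MinU P b d y × Θ x y) → b ≤ d
    upper (_ , y , x∈MinU , ((b≤y , _) , _) , xΘy) =
      ≤-trans b≤y (proj₂ (IsClass-closed isEquivalence [c′,d] (≤-refl , c′≤d) c′Θy))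
      where
      c′Θy : Θ c′ y
      c′Θy = subst (λ t → Θ t y) (MinU-of-≤ a≤c′ x∈MinU) xΘy

proposition3p5 : ∀ {c ℓ r} (P : Poset c ℓ) (Θ : Rel (Poset.Carrier P) r) →
    IsCongruence P Θ →
    ∀ (a b c′ d : Poset.Carrier P) →
    Poset._≤_ P a b → Poset._≤_ P c′ d →
    IsClass P Θ (Interval P a b) → IsClass P Θ (Interval P c′ d) →
    (Poset._≤_ P a c′ ⇔ Poset._≤_ P b d)
proposition3p5 P Θ cong a b c′ d a≤b c′≤d [a,b] [c′,d] = mk⇔
  (≤-lower⇒≤-upper P cong a≤b c′≤d [a,b] [c′,d])
  (≤-lower⇒≤-upper (dual P) (IsCongruence-dual P cong) c′≤d a≤b
    (IsClass-Interval-dual P [c′,d]) (IsClass-Interval-dual P [a,b]))
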